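{- Let $M=(X,d)$ be a metric space, let $P=\{P_i\}_{i=1}^t$ be a temporal-sampling of $M$ of size $n$, and let $\{\mathcal{C}_i\}_{i=1}^{t-1}$ be the $\delta$-local correspondences of a local $(\chi,\delta)$-temporal hierarchical clustering of $P$ (for some $\chi,\delta\ge 0$). Then the flow instance $F=F(\{\mathcal{C}_i\}_{i=1}^{t-1})$ is feasible, i.e. it admits an integral flow from $s$ to $s'$ in which every vertex $(i,v)$, $i\in[t]$, $v\in P_i$, has in-flow at least one, and such a flow exists with flow value at most $n$.
   Context: A temporal-sampling of a metric space $M=(X,d)$ of length $t$ is a sequence $P=\{P_i\}_{i=1}^t$ of finite, non-empty subsets of $X$; its size is $\sum_i|P_i|$. $M[Q]$ denotes the restriction of $M$ to $Q\subseteq X$. A pseudo-ultrametric is a pseudometric $\mu$ with $\mu(u,v)\le\max\{\mu(u,w),\mu(w,v)\}$ for all $u,v,w$. For pseudometrics $d_U,d_V$ on the same finite set $Y$, $L^\infty=\max_{p,p'\in Y}|d_U(p,p')-d_V(p,p')|$. A correspondence between $A$ and $B$ is a relation $\mathcal{C}\subseteq A\times B$ whose projections onto $A$ and onto $B$ are surjective. A local $(\chi,\delta)$-temporal hierarchical clustering of $P$ consists of pseudo-ultrametrics $\mu_i$ on $P_i$ with $L^\infty(M[P_i],(P_i,\mu_i))\le\chi$ and correspondences $\mathcal{C}_i$ between $P_i$ and $P_{i+1}$ with $d(u,v)\le\delta$ for all $(u,v)\in\mathcal{C}_i$ ($\delta$-local correspondences). The flow network $F(\{\mathcal{C}_i\})$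 is the directed graph with vertices a source $s$, a sink $s'$, and $(i,v)$ for each $i\in[t]$, $v\in P_i$; its edges are $s\to(1,v)$ for all $v\in P_1$, $(t,v)\to s'$ for all $v\in P_t$, and $(i,u)\to(i+1,v)$ for each $i\in[t-1]$ and $(u,v)\in\mathcal{C}_i$. Edges have no upper capacity; a flow is a nonnegative assignment to edges satisfying conservation at all vertices other than $s,s'$, and its value is the total flow leaving $s$. -}

module Defs where

open import Level using (0ℓ)
open import Data.Nat as ℕ using (ℕ; zero; suc)
open import Data.Fin using (Fin; zero; suc; inject₁; fromℕ)
open import Data.List using (List; length; lookup)
open import Data.List.Relation.Unary.Unique.Propositional using (Unique)
open import Data.Product using (Σ; _×_; ∃; ∃-syntax)
open import Data.Sum using (_⊎_)
open import Relation.Binary.Bundles using (TotalOrder)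
open import Relation.Binary.PropositionalEquality using (_≡_; _≢_)
import Algebra.Construct.NaturalChoice.Max as MaxConstr

∑ : ∀ {n} → (Fin n → ℕ) → ℕ
∑ {zero}  f = 0
∑ {suc n} f = f zero ℕ.+ ∑ (λ i → f (suc i))

-- Distance values: any totally ordered type with an addition and a zero
-- (the reals with their usual order, + and 0 are an instance).

record DistanceValues : Set₁ where
  field
    totalOrder : TotalOrder 0ℓ 0ℓ 0ℓ
  open TotalOrder totalOrder public
  field
    _+_ : Carrier → Carrier → Carrier
    0#  : Carrier
  open MaxConstr totalOrder public using (_⊔_)

record IsMetric (D : DistanceValues) {X : Set} (d : X → X → DistanceValues.Carrier D) : Set where
  open DistanceValues D
  field
    nonneg   : ∀ x y → 0# ≤ d x y
    zero-refl : ∀ x → d x x ≈ 0#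
    zero-eq  : ∀ x y → d x y ≈ 0# → x ≡ y
    sym      : ∀ x y → d x y ≈ d y x
    triangle : ∀ x y z → d x z ≤ (d x y + d y z)

-- Temporal samplings of length t = suc m.  P_i is a duplicate-free,
-- non-empty list of points of X; points of P_i are referred to by their
-- position, an element of Fin (∣ P i ∣).

record TemporalSampling (X : Set) (m : ℕ) : Set where
  field
    P        : Fin (suc m) → List X
    unique   : ∀ i → Unique (P i)
    nonEmpty : ∀ i → 1 ℕ.≤ length (P i)

  ∣_∣ : Fin (suc m) → ℕ
  ∣ i ∣ = length (P i)

  pt : (i : Fin (suc m)) → Fin ∣ i ∣ → X
  pt i = lookup (P i)

  size : ℕ
  size = ∑ ∣_∣

  -- P_i and P_{i+1} for the transition i ∈ {1,…,t-1}
  src tgt : Fin m → Fin (suc m)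
  src i = inject₁ i
  tgt i = suc i

record IsPseudoUltrametric (D : DistanceValues) {k : ℕ} (μ : Fin k → Fin k → DistanceValues.Carrier D) : Set where
  open DistanceValues D
  field
    nonneg      : ∀ u v → 0# ≤ μ u v
    zero-refl   : ∀ u → μ u u ≈ 0#
    sym         : ∀ u v → μ u v ≈ μ v u
    triangle    : ∀ u v w → μ u v ≤ (μ u w + μ w v)
    ultrametric : ∀ u v w → μ u v ≤ (μ u w ⊔ μ w v)

record IsCorrespondence {a b : ℕ} (C : Fin a → Fin b → Set) : Set where
  field
    left-total  : ∀ u → ∃[ v ] C u v
    right-total : ∀ v → ∃[ u ] C u v

record LocalTHC (D : DistanceValues) {X : Set} (d : X → X → DistanceValues.Carrier D)
                {m : ℕ} (S : TemporalSampling X m) (χ δ : DistanceValues.Carrier D) : Set₁ where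
  open DistanceValues D
  open TemporalSampling S
  field
    μ       : (i : Fin (suc m)) → Fin ∣ i ∣ → Fin ∣ i ∣ → Carrier
    μ-pum   : ∀ i → IsPseudoUltrametric D (μ i)
    -- L^∞(M[P_i], (P_i, μ_i)) ≤ χ, i.e. |d(p,p') - μ_i(p,p')| ≤ χ for all p,p'
    μ-close : ∀ i p p' → (d (pt i p) (pt i p') ≤ (μ i p p' + χ))
                       × (μ i p p' ≤ (d (pt i p) (pt i p') + χ))
    C       : (i : Fin m) → Fin ∣ src i ∣ → Fin ∣ tgt i ∣ → Set
    C-corr  : ∀ i → IsCorrespondence (C i)
    C-local : ∀ i u v → C i u v → d (pt (src i) u) (pt (tgt i) v) ≤ δ

-- Vertices: s, s', and (i,v) for i ∈ Fin (suc m), v ∈ Fin ∣ i ∣.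
-- Edge flows are given by
--   fs v        on s → (1,v),
--   fm i u v    on (i,u) → (i+1,v)   (required to vanish unless (u,v) ∈ C_i),
--   ft v        on (t,v) → s'.

record EdgeAssignment {X : Set} {m : ℕ} (S : TemporalSampling X m) : Set where
  open TemporalSampling S
  field
    fs : Fin ∣ zero ∣ → ℕ
    fm : (i : Fin m) → Fin ∣ src i ∣ → Fin ∣ tgt i ∣ → ℕ
    ft : Fin ∣ fromℕ m ∣ → ℕ

  inflow : (j : Fin (suc m)) → Fin ∣ j ∣ → ℕ
  inflow zero    v = fs v
  inflow (suc i) v = ∑ (λ u → fm i u v)

  outflow-mid : (i : Fin m) → Fin ∣ src i ∣ → ℕ
  outflow-mid i u = ∑ (λ v → fm i u v)

  value : ℕ
  value = ∑ fs

record IsIntegralFlow {X : Set} {m : ℕ} (S : TemporalSampling X m)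
                      (C : (i : Fin m) → Fin (TemporalSampling.∣_∣ S (TemporalSampling.src S i))
                                       → Fin (TemporalSampling.∣_∣ S (TemporalSampling.tgt S i)) → Set)
                      (f : EdgeAssignment S) : Set where
  open TemporalSampling S
  open EdgeAssignment f
  field
    fm-on-edges   : ∀ i u v → fm i u v ≢ 0 → C i u v
    -- flow conservation at every vertex (every layer of Fin (suc m) is
    -- either inject₁ i for i ∈ Fin m, or the last layer fromℕ m)
    conserve-mid  : ∀ i u → inflow (src i) u ≡ outflow-mid i u
    conserve-last : ∀ v → inflow (fromℕ m) v ≡ ft v

-- Because every C_i is left and right total, each vertex (j,w) lies on a thread:
-- a choice of one point per layer with consecutive points related by the C_i.
-- Sending one unit of flow along a thread through every vertex gives a flow
-- that enters every vertex, and whose value is the number of vertices, n.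

module Submission where

open import Defs
open import Data.Nat using (ℕ; zero; suc; _≤_; _+_; _*_; _≟_)
open import Data.Nat.Properties
  using (+-*-semiring; ≤-trans; ≤-reflexive; module ≤-Reasoning; m≤m+n; m≤n+m; *-identityˡ; *-identityʳ; *-zeroʳ)
open import Data.Fin using (Fin; inject₁; fromℕ) renaming (zero to fzero; suc to fsuc)
open import Data.Product using (Σ; _×_; _,_; proj₁; proj₂)
open import Relation.Binary.PropositionalEquality
open import Relation.Nullary using (yes; no; contradiction)
import Algebra.Properties.Semiring.Sum +-*-semiring as Sum

∑-cong : ∀ {k} {f g : Fin k → ℕ} → (∀ i → f i ≡ g i) → ∑ f ≡ ∑ g
∑-cong {zero}  f≗g = refl
∑-cong {suc k} f≗g = cong₂ _+_ (f≗g fzero) (∑-cong (λ i → f≗g (fsuc i)))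

∑≡sum : ∀ {k} (f : Fin k → ℕ) → ∑ f ≡ Sum.sum f
∑≡sum {zero}  f = refl
∑≡sum {suc k} f = cong (f fzero +_) (∑≡sum (λ i → f (fsuc i)))

∑-comm : ∀ {a b} (f : Fin a → Fin b → ℕ) →
         ∑ (λ x → ∑ (λ y → f x y)) ≡ ∑ (λ y → ∑ (λ x → f x y))
∑-comm f = begin
  ∑ (λ x → ∑ (λ y → f x y))             ≡⟨ ∑-cong (λ x → ∑≡sum (f x)) ⟩
  ∑ (λ x → Sum.sum (λ y → f x y))       ≡⟨ ∑≡sum (λ x → Sum.sum (λ y → f x y)) ⟩
  Sum.sum (λ x → Sum.sum (λ y → f x y)) ≡⟨ Sum.∑-comm f ⟩
  Sum.sum (λ y → Sum.sum (λ x → f x y)) ≡⟨ ∑≡sum (λ y → Sum.sum (λ x → f x y)) ⟨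
  ∑ (λ y → Sum.sum (λ x → f x y))       ≡⟨ ∑-cong (λ y → ∑≡sum (λ x → f x y)) ⟨
  ∑ (λ y → ∑ (λ x → f x y))             ∎
  where open ≡-Reasoning

∑-*ʳ : ∀ {k} (f : Fin k → ℕ) c → ∑ (λ i → f i * c) ≡ ∑ f * c
∑-*ʳ f c = begin
  ∑ (λ i → f i * c)       ≡⟨ ∑≡sum (λ i → f i * c) ⟩
  Sum.sum (λ i → f i * c) ≡⟨ Sum.*-distribʳ-sum c f ⟨
  Sum.sum f * c           ≡⟨ cong (_* c) (∑≡sum f) ⟨
  ∑ f * c                 ∎
  where open ≡-Reasoning

∑-*ˡ : ∀ {k} c (f : Fin k → ℕ) → ∑ (λ i → c * f i) ≡ c * ∑ f
∑-*ˡ c f = begin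
  ∑ (λ i → c * f i)       ≡⟨ ∑≡sum (λ i → c * f i) ⟩
  Sum.sum (λ i → c * f i) ≡⟨ Sum.*-distribˡ-sum c f ⟨
  c * Sum.sum f           ≡⟨ cong (c *_) (∑≡sum f) ⟨
  c * ∑ f                 ∎
  where open ≡-Reasoning

∑-zero : ∀ k → ∑ {k} (λ _ → 0) ≡ 0
∑-zero zero    = refl
∑-zero (suc k) = ∑-zero k

∑-one : ∀ k → ∑ {k} (λ _ → 1) ≡ k
∑-one zero    = refl
∑-one (suc k) = cong suc (∑-one k)

≤-∑ : ∀ {k} (f : Fin k → ℕ) i → f i ≤ ∑ f
≤-∑ f fzero    = m≤m+n (f fzero) _
≤-∑ f (fsuc i) = ≤-trans (≤-∑ (λ j → f (fsuc j)) i) (m≤n+m _ (f fzero))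

∑≢0⇒∃≢0 : ∀ {k} (f : Fin k → ℕ) → ∑ f ≢ 0 → Σ (Fin k) (λ i → f i ≢ 0)
∑≢0⇒∃≢0 {zero}  f ∑f≢0 = contradiction refl ∑f≢0
∑≢0⇒∃≢0 {suc k} f ∑f≢0 with f fzero ≟ 0
... | no  f₀≢0 = fzero , f₀≢0
... | yes f₀≡0 =
  let i , fᵢ≢0 = ∑≢0⇒∃≢0 (λ i → f (fsuc i)) (λ ∑≡0 → ∑f≢0 (cong₂ _+_ f₀≡0 ∑≡0))
  in  fsuc i , fᵢ≢0

*≢0⇒≢0 : ∀ a b → a * b ≢ 0 → a ≢ 0 × b ≢ 0
*≢0⇒≢0 a b ab≢0 = (λ a≡0 → ab≢0 (cong (_* b) a≡0))
                 , (λ b≡0 → ab≢0 (trans (cong (a *_) b≡0) (*-zeroʳ a)))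

kronecker : ∀ {k} → Fin k → Fin k → ℕ
kronecker fzero    fzero    = 1
kronecker fzero    (fsuc _) = 0
kronecker (fsuc _) fzero    = 0
kronecker (fsuc a) (fsuc b) = kronecker a b

kronecker-diag : ∀ {k} (a : Fin k) → kronecker a a ≡ 1
kronecker-diag fzero    = refl
kronecker-diag (fsuc a) = kronecker-diag a

kronecker≢0⇒≡ : ∀ {k} (a b : Fin k) → kronecker a b ≢ 0 → a ≡ b
kronecker≢0⇒≡ fzero    fzero    _  = refl
kronecker≢0⇒≡ fzero    (fsuc b) ≢0 = contradiction refl ≢0
kronecker≢0⇒≡ (fsuc a) fzero    ≢0 = contradiction refl ≢0
kronecker≢0⇒≡ (fsuc a) (fsuc b) ≢0 = cong fsuc (kronecker≢0⇒≡ a b ≢0)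

∑-kronecker : ∀ {k} (a : Fin k) → ∑ (kronecker a) ≡ 1
∑-kronecker {suc k} fzero    = cong suc (∑-zero k)
∑-kronecker {suc k} (fsuc a) = ∑-kronecker a

record Thread {m : ℕ} (n : Fin (suc m) → ℕ)
              (C : (k : Fin m) → Fin (n (inject₁ k)) → Fin (n (fsuc k)) → Set) : Set where
  constructor thread
  field
    point  : (i : Fin (suc m)) → Fin (n i)
    linked : ∀ k → C k (point (inject₁ k)) (point (fsuc k))

open Thread

module _ {m : ℕ} {n : Fin (suc (suc m)) → ℕ}
         {C : (k : Fin (suc m)) → Fin (n (inject₁ k)) → Fin (n (fsuc k)) → Set} where

  _◃_∣_ : (w : Fin (n fzero)) (p : Thread (λ i → n (fsuc i)) (λ k → C (fsuc k))) →
          C fzero w (point p fzero) → Thread n C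
  w ◃ p ∣ c = thread (λ { fzero → w ; (fsuc i) → point p i })
                     (λ { fzero → c ; (fsuc k) → linked p k })

thread-through : ∀ {m} {n : Fin (suc m) → ℕ}
                 {C : (k : Fin m) → Fin (n (inject₁ k)) → Fin (n (fsuc k)) → Set} →
                 (∀ k → IsCorrespondence (C k)) →
                 ∀ j w → Σ (Thread n C) (λ p → point p j ≡ w)
thread-through {zero} corr fzero w = thread (λ { fzero → w }) (λ ()) , refl
thread-through {suc m} {C = C} corr fzero w =
  let v , c    = IsCorrespondence.left-total (corr fzero) w
      p , p₀≡v = thread-through (λ k → corr (fsuc k)) fzero v
  in  w ◃ p ∣ subst (C fzero w) (sym p₀≡v) c , refl
thread-through {suc m} corr (fsuc j) w =
  let p , pⱼ≡w = thread-through (λ k → corr (fsuc k)) j w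
      u , c    = IsCorrespondence.right-total (corr fzero) (point p fzero)
  in  u ◃ p ∣ c , pⱼ≡w

module Flows {X : Set} {m : ℕ} (S : TemporalSampling X m)
             (C : (k : Fin m) → Fin (TemporalSampling.∣_∣ S (inject₁ k))
                              → Fin (TemporalSampling.∣_∣ S (fsuc k)) → Set) where

  open TemporalSampling S
  open EdgeAssignment
  open IsIntegralFlow

  ∑ᴱ : ∀ {a} → (Fin a → EdgeAssignment S) → EdgeAssignment S
  ∑ᴱ F = record
    { fs = λ v → ∑ (λ x → fs (F x) v)
    ; fm = λ k u v → ∑ (λ x → fm (F x) k u v)
    ; ft = λ v → ∑ (λ x → ft (F x) v)
    }

  module _ {a} (F : Fin a → EdgeAssignment S) where

    inflow-∑ᴱ : ∀ j v → inflow (∑ᴱ F) j v ≡ ∑ (λ x → inflow (F x) j v)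
    inflow-∑ᴱ fzero    v = refl
    inflow-∑ᴱ (fsuc k) v = ∑-comm (λ u x → fm (F x) k u v)

    outflow-mid-∑ᴱ : ∀ k u → outflow-mid (∑ᴱ F) k u ≡ ∑ (λ x → outflow-mid (F x) k u)
    outflow-mid-∑ᴱ k u = ∑-comm (λ v x → fm (F x) k u v)

    value-∑ᴱ : value (∑ᴱ F) ≡ ∑ (λ x → value (F x))
    value-∑ᴱ = ∑-comm (λ v x → fs (F x) v)

    inflow-≤-∑ᴱ : ∀ x j v → inflow (F x) j v ≤ inflow (∑ᴱ F) j v
    inflow-≤-∑ᴱ x j v = subst (inflow (F x) j v ≤_) (sym (inflow-∑ᴱ j v))
                              (≤-∑ (λ y → inflow (F y) j v) x)

    ∑ᴱ-isIntegralFlow : (∀ x → IsIntegralFlow S C (F x)) → IsIntegralFlow S C (∑ᴱ F)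
    ∑ᴱ-isIntegralFlow flow = record
      { fm-on-edges   = λ k u v ∑≢0 →
          let x , fₓ≢0 = ∑≢0⇒∃≢0 (λ x → fm (F x) k u v) ∑≢0
          in  fm-on-edges (flow x) k u v fₓ≢0
      ; conserve-mid  = λ k u → begin
          inflow (∑ᴱ F) (inject₁ k) u            ≡⟨ inflow-∑ᴱ (inject₁ k) u ⟩
          ∑ (λ x → inflow (F x) (inject₁ k) u)   ≡⟨ ∑-cong (λ x → conserve-mid (flow x) k u) ⟩
          ∑ (λ x → outflow-mid (F x) k u)        ≡⟨ outflow-mid-∑ᴱ k u ⟨
          outflow-mid (∑ᴱ F) k u                 ∎
      ; conserve-last = λ v →
          trans (inflow-∑ᴱ (fromℕ m) v) (∑-cong (λ x → conserve-last (flow x) v))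
      }
      where open ≡-Reasoning

  module _ (p : Thread ∣_∣ C) where

    unitFlow : EdgeAssignment S
    unitFlow = record
      { fs = kronecker (point p fzero)
      ; fm = λ k u v → kronecker (point p (inject₁ k)) u * kronecker (point p (fsuc k)) v
      ; ft = kronecker (point p (fromℕ m))
      }

    inflow-unitFlow : ∀ j v → inflow unitFlow j v ≡ kronecker (point p j) v
    inflow-unitFlow fzero    v = refl
    inflow-unitFlow (fsuc k) v = begin
      ∑ (λ u → kronecker (point p (inject₁ k)) u * δᵥ) ≡⟨ ∑-*ʳ (kronecker (point p (inject₁ k))) δᵥ ⟩
      ∑ (kronecker (point p (inject₁ k))) * δᵥ         ≡⟨ cong (_* δᵥ) (∑-kronecker (point p (inject₁ k))) ⟩
      1 * δᵥ                                           ≡⟨ *-identityˡ δᵥ ⟩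
      δᵥ                                               ∎
      where
      open ≡-Reasoning
      δᵥ = kronecker (point p (fsuc k)) v

    outflow-mid-unitFlow : ∀ k u → outflow-mid unitFlow k u ≡ kronecker (point p (inject₁ k)) u
    outflow-mid-unitFlow k u = begin
      ∑ (λ v → δᵤ * kronecker (point p (fsuc k)) v) ≡⟨ ∑-*ˡ δᵤ (kronecker (point p (fsuc k))) ⟩
      δᵤ * ∑ (kronecker (point p (fsuc k)))         ≡⟨ cong (δᵤ *_) (∑-kronecker (point p (fsuc k))) ⟩
      δᵤ * 1                                        ≡⟨ *-identityʳ δᵤ ⟩
      δᵤ                                            ∎
      where
      open ≡-Reasoning
      δᵤ = kronecker (point p (inject₁ k)) u

    value-unitFlow : value unitFlow ≡ 1
    value-unitFlow = ∑-kronecker (point p fzero)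

    unitFlow-isIntegralFlow : IsIntegralFlow S C unitFlow
    unitFlow-isIntegralFlow = record
      { fm-on-edges   = λ k u v ≢0 →
          let pₖ≡u , pₖ₊₁≡v = *≢0⇒≢0 _ _ ≢0
          in  subst₂ (C k) (kronecker≢0⇒≡ _ u pₖ≡u) (kronecker≢0⇒≡ _ v pₖ₊₁≡v) (linked p k)
      ; conserve-mid  = λ k u → trans (inflow-unitFlow (inject₁ k) u) (sym (outflow-mid-unitFlow k u))
      ; conserve-last = λ v → inflow-unitFlow (fromℕ m) v
      }

lemma7 : (D : DistanceValues) {X : Set} (d : X → X → DistanceValues.Carrier D)
    → IsMetric D d
    → (m : ℕ) (S : TemporalSampling X m)
    → (χ δ : DistanceValues.Carrier D)
    → DistanceValues._≤_ D (DistanceValues.0# D) χ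
    → DistanceValues._≤_ D (DistanceValues.0# D) δ
    → (H : LocalTHC D d S χ δ)
    → Σ (EdgeAssignment S) (λ f →
    IsIntegralFlow S (LocalTHC.C H) f
    × (∀ j v → 1 ≤ EdgeAssignment.inflow f j v)
    × EdgeAssignment.value f ≤ TemporalSampling.size S)
lemma7 D d _ m S χ δ _ _ H = flow , isFlow , covers , ≤-reflexive value≡size
  where
  open TemporalSampling S
  open EdgeAssignment
  open LocalTHC H using (C; C-corr)
  open Flows S C

  through : ∀ j w → Thread ∣_∣ C
  through j w = proj₁ (thread-through C-corr j w)

  layerFlow : Fin (suc m) → EdgeAssignment S
  layerFlow j = ∑ᴱ (λ w → unitFlow (through j w))

  flow : EdgeAssignment S
  flow = ∑ᴱ layerFlow

  isFlow : IsIntegralFlow S C flow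
  isFlow = ∑ᴱ-isIntegralFlow layerFlow (λ j → ∑ᴱ-isIntegralFlow _ (λ w → unitFlow-isIntegralFlow (through j w)))

  covers : ∀ j v → 1 ≤ inflow flow j v
  covers j v = begin
    1                                   ≡⟨ kronecker-diag v ⟨
    kronecker v v                       ≡⟨ cong (λ x → kronecker x v) (proj₂ (thread-through C-corr j v)) ⟨
    kronecker (point (through j v) j) v ≡⟨ inflow-unitFlow (through j v) j v ⟨
    inflow (unitFlow (through j v)) j v ≤⟨ inflow-≤-∑ᴱ (λ w → unitFlow (through j w)) v j v ⟩
    inflow (layerFlow j) j v            ≤⟨ inflow-≤-∑ᴱ layerFlow j j v ⟩
    inflow flow j v                     ∎
    where open ≤-Reasoning

  value≡size : value flow ≡ size
  value≡size = begin
    value flow                                           ≡⟨ value-∑ᴱ layerFlow ⟩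
    ∑ (λ j → value (layerFlow j))                        ≡⟨ ∑-cong (λ j → value-∑ᴱ (λ w → unitFlow (through j w))) ⟩
    ∑ (λ j → ∑ (λ w → value (unitFlow (through j w))))   ≡⟨ ∑-cong (λ j → ∑-cong (λ w → value-unitFlow (through j w))) ⟩
    ∑ (λ j → ∑ {∣ j ∣} (λ _ → 1))                         ≡⟨ ∑-cong (λ j → ∑-one ∣ j ∣) ⟩
    size                                                 ∎
    where open ≡-Reasoning
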